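{- Let $p$ be a prime and $2\le N\le p$ an integer. If $S\subseteq\mathbb{F}_p$ satisfies $|S|\ge 2(r_3([N])/N)p$, then $$\Lambda(S)\ge\frac{2r_3([N])}{N^3+O(N^2)},$$ where the implied constant in $O(N^2)$ is absolute.
   Context: $[N]=\{1,2,\dots,N\}\subseteq\mathbb{Z}$, and $r_3([N])$ is the size of the largest subset of $[N]$ containing no solution to $x+y=2z$ with $x\neq y$. For $S\subseteq\mathbb{F}_p$, $\Lambda(S):=p^{ -2}\sum_{n,d\in\mathbb{F}_p}1_S(n)1_S(n+d)1_S(n+2d)$. -}

module Defs where

open import Data.Nat using (ℕ; zero; suc; _+_; _*_; _∸_; _≤_; NonZero)
open import Data.Nat.DivMod using (_mod_)
open import Data.Bool using (Bool; true; false; if_then_else_)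
open import Data.Fin using (Fin; toℕ)
open import Data.Fin.Subset using (Subset; _∈_; ∣_∣)
open import Data.Vec using (lookup)
open import Data.List using (map; allFin)
open import Data.Nat.ListAction using (sum)
open import Data.Integer using (+_)
open import Data.Rational.Unnormalised using (ℚᵘ; mkℚᵘ)
open import Data.Product using (∃-syntax; _×_)
open import Relation.Binary.PropositionalEquality using (_≡_)

-- A subset A ⊆ Fin N represents the subset {i + 1 | i ∈ A} of [N] = {1,…,N}.
-- A is 3-AP-free: no solution of x + y = 2z with x ≠ y (x,y,z ∈ A, as elements of [N]).
ThreeAPFree : (N : ℕ) → Subset N → Set
ThreeAPFree N A = ∀ (x y z : Fin N) → x ∈ A → y ∈ A → z ∈ A →
  suc (toℕ x) + suc (toℕ y) ≡ 2 * suc (toℕ z) → x ≡ y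

IsR3 : ℕ → ℕ → Set
IsR3 N r = (∃[ A ] (ThreeAPFree N A × ∣ A ∣ ≡ r))
         × (∀ (A : Subset N) → ThreeAPFree N A → ∣ A ∣ ≤ r)

ind : Bool → ℕ
ind b = if b then 1 else 0

-- Fin p models 𝔽_p, with addition mod p.
-- count p S = Σ_{n,d ∈ 𝔽_p} 1_S(n) 1_S(n+d) 1_S(n+2d)
count : (p : ℕ) .{{_ : NonZero p}} → Subset p → ℕ
count p S = sum (map (λ n → sum (map (λ d →
    ind (lookup S n)
  * ind (lookup S ((toℕ n + toℕ d) mod p))
  * ind (lookup S ((toℕ n + 2 * toℕ d) mod p))) (allFin p))) (allFin p))

-- Λ(S) = p⁻² · count p S  (mkℚᵘ a b denotes a / (b+1); p*p ≥ 1 since p ≠ 0)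
Λ : (p : ℕ) .{{_ : NonZero p}} → Subset p → ℚᵘ
Λ p S = mkℚᵘ (+ count p S) (p * p ∸ 1)

-- the rational a / b for b ≥ 1 (b is used only with b ≥ 1 below)
frac : ℕ → ℕ → ℚᵘ
frac a b = mkℚᵘ (+ a) (b ∸ 1)

-- Varnavides averaging. For a, d ∈ 𝔽_p look at the progressions a, a + d, …, a + (N-1)d.
-- Together they meet S in p·N·|S| points (with multiplicity). One that meets S in more than
-- r = r₃([N]) points contains a 3-AP of S at positions x < z < 2z - x, so
-- p·N·|S| ≤ p²·r + N·#{(a, d, x, z) : such an AP occurs}. A pair x < z and a 3-AP (n, e) of S
-- determine (a, d) uniquely, by d = e/(z - x) and a = n - x·d, because 0 < z - x < N ≤ p is
-- invertible mod p. Hence p·N·|S| ≤ p²·r + N·(N²/2)·p²·Λ(S), and |S| ≥ 2rp/N gives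
-- Λ(S) ≥ 2r/N³, i.e. the theorem with C = 0.

module Submission where

open import Defs
open import Data.Nat
  using (ℕ; zero; suc; _+_; _*_; _^_; _∸_; _≤_; _<_; _<?_; z≤n; s≤s; NonZero; >-nonZero; >-nonZero⁻¹)
open import Data.Nat.Properties
open import Data.Nat.DivMod
  using (_%_; _/_; _mod_; m≡m%n+[m/n]*n; m<n⇒m%n≡m; m%n<n; m%n%n≡m%n; %-distribˡ-+; %-distribˡ-*)
open import Data.Nat.Divisibility using (_∣_; divides; n∣m⇒m%n≡0; >⇒∤)
open import Data.Nat.Primality using (Prime; euclidsLemma)
open import Data.Fin as Fin using (Fin; toℕ; punchOut)
open import Data.Fin.Properties using (any?; pigeonhole; punchOut-injective; toℕ-injective; toℕ<n; toℕ-fromℕ<)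
  renaming (_≟_ to _≟ᶠ_; <⇒≢ to <⇒≢ᶠ)
open import Data.Fin.Permutation using (Permutation′; permutation)
open import Data.Fin.Subset using (Subset; ∣_∣; _∈_)
open import Data.Fin.Subset.Properties using (∣p∣≤n)
open import Data.Vec using (lookup; _∷_; [])
import Data.Vec as Vec
open import Data.Vec.Properties using (lookup∘tabulate; []=⇒lookup)
open import Data.Bool using (true; false)
open import Relation.Nullary.Decidable using (⌊_⌋)
open import Data.Nat.Tactic.RingSolver using (solve-∀)
open import Data.List using (map; allFin; tabulate)
import Data.Nat.ListAction as List
open import Data.Rational.Unnormalised using (*≤*) renaming (_≤_ to _≤ᵘ_)
import Data.Integer as ℤ
import Data.Integer.Properties as ℤ
open import Data.Product using (∃-syntax; _×_; _,_; proj₁; proj₂)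
open import Data.Empty using (⊥-elim)
open import Data.Sum using (inj₁; inj₂)
open import Function using (_∘_; id)
open import Function.Bundles using (_⇔_; mk⇔; module Equivalence)
open import Function.Definitions using (Injective)
open import Relation.Nullary using (yes; no)
open import Relation.Binary using (tri<; tri≈; tri>)
open import Relation.Binary.PropositionalEquality
open import Algebra.Properties.Semiring.Sum +-*-semiring
  using ( sum; sum-syntax; sum-cong-≗; sum-replicate-zero; ∑-comm; ∑-distrib-+; ∑-permute
        ; *-distribˡ-sum; *-distribʳ-sum)

private variable
  m n o d : ℕ

sum-map-tabulate : ∀ {A : Set} n (f : A → ℕ) (g : Fin n → A) →
                   List.sum (map f (tabulate g)) ≡ ∑[ i < n ] f (g i)
sum-map-tabulate zero    f g = refl
sum-map-tabulate (suc n) f g = cong (f (g Fin.zero) +_) (sum-map-tabulate n f (g ∘ Fin.suc))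

∑-const : ∀ n c → ∑[ i < n ] c ≡ n * c
∑-const zero    c = refl
∑-const (suc n) c = cong (c +_) (∑-const n c)

∑-mono-≤ : ∀ {f g : Fin n → ℕ} → (∀ i → f i ≤ g i) → sum f ≤ sum g
∑-mono-≤ {zero}  f≤g = z≤n
∑-mono-≤ {suc n} f≤g = +-mono-≤ (f≤g Fin.zero) (∑-mono-≤ (f≤g ∘ Fin.suc))

≤-∑ : ∀ (f : Fin n → ℕ) i → f i ≤ sum f
≤-∑ f Fin.zero    = m≤m+n _ _
≤-∑ f (Fin.suc i) = ≤-trans (≤-∑ (f ∘ Fin.suc) i) (m≤n+m _ _)

∣∣≡∑ : ∀ {n} (A : Subset n) → ∣ A ∣ ≡ ∑[ i < n ] ind (lookup A i)
∣∣≡∑ []          = refl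
∣∣≡∑ (true ∷ A)  = cong suc (∣∣≡∑ A)
∣∣≡∑ (false ∷ A) = ∣∣≡∑ A

∑∑-comm : ∀ {k l m n} (f : Fin k → Fin l → Fin m → Fin n → ℕ) →
          ∑[ i < k ] ∑[ j < l ] ∑[ u < m ] ∑[ v < n ] f i j u v ≡
          ∑[ u < m ] ∑[ v < n ] ∑[ i < k ] ∑[ j < l ] f i j u v
∑∑-comm {k} {l} {m} {n} f = begin
  ∑[ i < k ] ∑[ j < l ] ∑[ u < m ] ∑[ v < n ] f i j u v
    ≡⟨ sum-cong-≗ (λ i → ∑-comm (λ j u → ∑[ v < n ] f i j u v)) ⟩
  ∑[ i < k ] ∑[ u < m ] ∑[ j < l ] ∑[ v < n ] f i j u v
    ≡⟨ sum-cong-≗ (λ i → sum-cong-≗ (λ u → ∑-comm (λ j v → f i j u v))) ⟩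
  ∑[ i < k ] ∑[ u < m ] ∑[ v < n ] ∑[ j < l ] f i j u v
    ≡⟨ ∑-comm (λ i u → ∑[ v < n ] ∑[ j < l ] f i j u v) ⟩
  ∑[ u < m ] ∑[ i < k ] ∑[ v < n ] ∑[ j < l ] f i j u v
    ≡⟨ sum-cong-≗ (λ u → ∑-comm (λ i v → ∑[ j < l ] f i j u v)) ⟩
  ∑[ u < m ] ∑[ v < n ] ∑[ i < k ] ∑[ j < l ] f i j u v ∎
  where open ≡-Reasoning

injective⇒surjective : ∀ {f : Fin n → Fin n} → Injective _≡_ _≡_ f → ∀ j → ∃[ i ] f i ≡ j
injective⇒surjective {zero}  inj ()
injective⇒surjective {suc n} {f} inj j with any? (λ i → f i ≟ᶠ j)
... | yes preimage = preimage
... | no ∄preimage =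
  let i , k , i<k , same = pigeonhole (n<1+n n) (λ i → punchOut {i = j} (misses i))
  in ⊥-elim (<⇒≢ᶠ i<k (inj (punchOut-injective (misses i) (misses k) same)))
  where
  misses : ∀ i → j ≢ f i
  misses i j≡fi = ∄preimage (i , sym j≡fi)

∑-reindex : (f : Fin n → Fin n) → Injective _≡_ _≡_ f →
            ∀ (g : Fin n → ℕ) → ∑[ i < n ] g (f i) ≡ sum g
∑-reindex {n} f inj g = sym (∑-permute g π)
  where
  f⁻¹ : Fin n → Fin n
  f⁻¹ = λ j → proj₁ (injective⇒surjective inj j)
  π : Permutation′ _
  π = permutation f f⁻¹ (λ j → proj₂ (injective⇒surjective inj j))
                        (λ i → inj (proj₂ (injective⇒surjective inj (f i))))

toℕ-mod : ∀ m d .{{_ : NonZero d}} → toℕ (m mod d) ≡ m % d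
toℕ-mod m d = toℕ-fromℕ< (m%n<n m d)

mod-cong : .{{_ : NonZero d}} → m % d ≡ o % d → m mod d ≡ o mod d
mod-cong {d} {m} {o} eq = toℕ-injective (trans (toℕ-mod m d) (trans eq (sym (toℕ-mod o d))))

%-+-cong : ∀ {a a' b b'} d .{{_ : NonZero d}} → a % d ≡ a' % d → b % d ≡ b' % d →
           (a + b) % d ≡ (a' + b') % d
%-+-cong {a} {a'} {b} {b'} d a≡a' b≡b' = begin
  (a + b) % d             ≡⟨ %-distribˡ-+ a b d ⟩
  (a % d + b % d) % d     ≡⟨ cong₂ (λ u v → (u + v) % d) a≡a' b≡b' ⟩
  (a' % d + b' % d) % d   ≡⟨ %-distribˡ-+ a' b' d ⟨
  (a' + b') % d           ∎
  where open ≡-Reasoning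

%-*-cong : ∀ {b b'} k d .{{_ : NonZero d}} → b % d ≡ b' % d → (k * b) % d ≡ (k * b') % d
%-*-cong {b} {b'} k d b≡b' = begin
  (k * b) % d             ≡⟨ %-distribˡ-* k b d ⟩
  (k % d * (b % d)) % d   ≡⟨ cong (λ u → (k % d * u) % d) b≡b' ⟩
  (k % d * (b' % d)) % d  ≡⟨ %-distribˡ-* k b' d ⟨
  (k * b') % d            ∎
  where open ≡-Reasoning

%≡%⇒∣∸ : ∀ m n d .{{_ : NonZero d}} → m % d ≡ n % d → d ∣ m ∸ n
%≡%⇒∣∸ m n d eq = divides (m / d ∸ n / d) (begin
  m ∸ n                                     ≡⟨ cong₂ _∸_ (m≡m%n+[m/n]*n m d) (m≡m%n+[m/n]*n n d) ⟩
  (m % d + m / d * d) ∸ (n % d + n / d * d) ≡⟨ cong (λ r → (r + m / d * d) ∸ (n % d + n / d * d)) eq ⟩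
  (n % d + m / d * d) ∸ (n % d + n / d * d) ≡⟨ [m+n]∸[m+o]≡n∸o (n % d) _ _ ⟩
  m / d * d ∸ n / d * d                     ≡⟨ *-distribʳ-∸ d (m / d) (n / d) ⟨
  (m / d ∸ n / d) * d                       ∎)
  where open ≡-Reasoning

∣∸⇒≡ : .{{_ : NonZero d}} → m < d → n < d → d ∣ m ∸ n → d ∣ n ∸ m → m ≡ n
∣∸⇒≡ {d} {m} {n} m<d n<d d∣m∸n d∣n∸m =
  ≤-antisym (m∸n≡0⇒m≤n (small (m∸n≤m m n) m<d d∣m∸n))
            (m∸n≡0⇒m≤n (small (m∸n≤m n m) n<d d∣n∸m))
  where
  small : ∀ {k l} → k ≤ l → l < d → d ∣ k → k ≡ 0
  small k≤l l<d d∣k = trans (sym (m<n⇒m%n≡m (≤-<-trans k≤l l<d))) (n∣m⇒m%n≡0 _ d d∣k)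

mod-injective : ∀ d .{{_ : NonZero d}} (f : ℕ → ℕ) → (∀ m n → d ∣ f m ∸ f n → d ∣ m ∸ n) →
                Injective _≡_ _≡_ (λ (a : Fin d) → f (toℕ a) mod d)
mod-injective d f cancel {a} {b} fa≡fb =
  toℕ-injective (∣∸⇒≡ (toℕ<n a) (toℕ<n b) (cancel _ _ (%≡%⇒∣∸ _ _ d fa%≡fb%))
                                          (cancel _ _ (%≡%⇒∣∸ _ _ d (sym fa%≡fb%))))
  where
  fa%≡fb% : f (toℕ a) % d ≡ f (toℕ b) % d
  fa%≡fb% = trans (sym (toℕ-mod _ d)) (trans (cong toℕ fa≡fb) (toℕ-mod _ d))

+-mod-injective : ∀ d .{{_ : NonZero d}} c → Injective _≡_ _≡_ (λ (a : Fin d) → (toℕ a + c) mod d)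
+-mod-injective d c = mod-injective d (_+ c) (λ m n → subst (d ∣_) (m+c∸n+c m n))
  where
  m+c∸n+c : ∀ m n → (m + c) ∸ (n + c) ≡ m ∸ n
  m+c∸n+c m n = trans (cong₂ _∸_ (+-comm m c) (+-comm n c)) ([m+n]∸[m+o]≡n∸o c m n)

*-mod-injective : ∀ p .{{_ : NonZero p}} → Prime p → ∀ t .{{_ : NonZero t}} → t < p →
                  Injective _≡_ _≡_ (λ (a : Fin p) → (t * toℕ a) mod p)
*-mod-injective p p-prime t t<p = mod-injective p (t *_) cancel
  where
  cancel : ∀ m n → p ∣ t * m ∸ t * n → p ∣ m ∸ n
  cancel m n p∣tm∸tn
    with euclidsLemma t (m ∸ n) p-prime (subst (p ∣_) (sym (*-distribˡ-∸ t m n)) p∣tm∸tn)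
  ... | inj₁ p∣t   = ⊥-elim (>⇒∤ t<p p∣t)
  ... | inj₂ p∣m∸n = p∣m∸n

3AP-shape : ∀ {x y z} → x + y ≡ 2 * z → x < y → x < z × z ≡ x + (z ∸ x) × y ≡ x + 2 * (z ∸ x)
3AP-shape {x} {y} {z} x+y≡2z x<y = x<z , z≡x+t , y≡x+2t
  where
  open ≤-Reasoning
  double-split : ∀ x t → 2 * (x + t) ≡ x + (x + 2 * t)
  double-split = solve-∀
  x<z : x < z
  x<z = *-cancelˡ-< 2 x z (begin-strict
    2 * x   ≡⟨ cong (x +_) (+-identityʳ x) ⟩
    x + x   <⟨ +-monoʳ-< x x<y ⟩
    x + y   ≡⟨ x+y≡2z ⟩
    2 * z   ∎)
  z≡x+t : z ≡ x + (z ∸ x)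
  z≡x+t = sym (m+[n∸m]≡n (<⇒≤ x<z))
  y≡x+2t : y ≡ x + 2 * (z ∸ x)
  y≡x+2t = +-cancelˡ-≡ x y _ (begin-equality
    x + y                   ≡⟨ x+y≡2z ⟩
    2 * z                   ≡⟨ cong (2 *_) z≡x+t ⟩
    2 * (x + (z ∸ x))       ≡⟨ double-split x (z ∸ x) ⟩
    x + (x + 2 * (z ∸ x))   ∎)

pred-3AP : ∀ {x y z} → suc x + suc y ≡ 2 * suc z → x + y ≡ 2 * z
pred-3AP {x} {y} {z} eq = suc-injective (trans (sym (+-suc x y)) (trans (suc-injective eq) (+-suc z (z + 0))))

density-arithmetic : ∀ {r p N s c K} → 2 * r * p ≤ s * N → p * (N * s) ≤ p * (p * r) + K * c * N →
                     K + K ≤ N * N → 2 * r * (p * p) ≤ c * N ^ 3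
density-arithmetic {r} {p} {N} {s} {c} {K} dense counted K+K≤N*N = begin
  2 * r * (p * p)     ≡⟨ *-assoc 2 r (p * p) ⟩
  2 * (r * (p * p))   ≤⟨ *-monoʳ-≤ 2 rp²≤KcN ⟩
  2 * (K * c * N)     ≡⟨ double-split K c N ⟩
  (K + K) * (c * N)   ≤⟨ *-monoˡ-≤ (c * N) K+K≤N*N ⟩
  N * N * (c * N)     ≡⟨ cube N c ⟩
  c * N ^ 3           ∎
  where
  open ≤-Reasoning
  double-split : ∀ K c N → 2 * (K * c * N) ≡ (K + K) * (c * N)
  double-split = solve-∀
  cube : ∀ N c → N * N * (c * N) ≡ c * (N * (N * (N * 1)))
  cube = solve-∀
  rp²-twice : ∀ r p → r * (p * p) + r * (p * p) ≡ p * (2 * r * p)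
  rp²-twice = solve-∀
  rp²-comm : ∀ p r → p * (p * r) ≡ r * (p * p)
  rp²-comm = solve-∀
  rp²≤KcN : r * (p * p) ≤ K * c * N
  rp²≤KcN = +-cancelˡ-≤ (r * (p * p)) _ _ (begin
    r * (p * p) + r * (p * p)   ≡⟨ rp²-twice r p ⟩
    p * (2 * r * p)             ≤⟨ *-monoʳ-≤ p dense ⟩
    p * (s * N)                 ≡⟨ cong (p *_) (*-comm s N) ⟩
    p * (N * s)                 ≤⟨ counted ⟩
    p * (p * r) + K * c * N     ≡⟨ cong (_+ K * c * N) (rp²-comm p r) ⟩
    r * (p * p) + K * c * N     ∎)

module Counting (p : ℕ) .{{_ : NonZero p}} (S : Subset p) where

  χ : ℕ → ℕ
  χ m = ind (lookup S (m mod p))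

  triple : Fin p → Fin p → ℕ
  triple n d = ind (lookup S n)
             * ind (lookup S ((toℕ n + toℕ d) mod p))
             * ind (lookup S ((toℕ n + 2 * toℕ d) mod p))

  triples : ℕ
  triples = ∑[ n < p ] ∑[ e < p ] triple n e

  count≡triples : count p S ≡ triples
  count≡triples = trans (sum-map-tabulate p _ id) (sum-cong-≗ (λ n → sum-map-tabulate p (triple n) id))

  triple-mod : ∀ m e → triple (m mod p) (e mod p) ≡ χ m * χ (m + e) * χ (m + 2 * e)
  triple-mod m e = cong₂ (λ u v → χ m * ind (lookup S u) * ind (lookup S v))
    (mod-cong (%-+-cong p (toℕ-mod-% m) (toℕ-mod-% e)))
    (mod-cong (%-+-cong p (toℕ-mod-% m) (%-*-cong 2 p (toℕ-mod-% e))))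
    where
    toℕ-mod-% : ∀ m → toℕ (m mod p) % p ≡ m % p
    toℕ-mod-% m = trans (cong (_% p) (toℕ-mod m p)) (m%n%n≡m%n m p)

  ∑χ[+c]≡∣S∣ : ∀ c → ∑[ a < p ] χ (toℕ a + c) ≡ ∣ S ∣
  ∑χ[+c]≡∣S∣ c =
    trans (∑-reindex (λ a → (toℕ a + c) mod p) (+-mod-injective p c) (ind ∘ lookup S)) (sym (∣∣≡∑ S))

  ∑∑triple-affine : Prime p → ∀ x t .{{_ : NonZero t}} → t < p →
    ∑[ a < p ] ∑[ d < p ] triple ((toℕ a + x * toℕ d) mod p) ((t * toℕ d) mod p) ≡ triples
  ∑∑triple-affine p-prime x t t<p = begin
    ∑[ a < p ] ∑[ d < p ] triple ((toℕ a + x * toℕ d) mod p) ((t * toℕ d) mod p)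
      ≡⟨ ∑-comm {p} {p} (λ a d → triple ((toℕ a + x * toℕ d) mod p) ((t * toℕ d) mod p)) ⟩
    ∑[ d < p ] ∑[ a < p ] triple ((toℕ a + x * toℕ d) mod p) ((t * toℕ d) mod p)
      ≡⟨ sum-cong-≗ {p} (λ d → ∑-reindex (λ a → (toℕ a + x * toℕ d) mod p)
                                         (+-mod-injective p (x * toℕ d))
                                         (λ n → triple n ((t * toℕ d) mod p))) ⟩
    ∑[ d < p ] ∑[ n < p ] triple n ((t * toℕ d) mod p)
      ≡⟨ ∑-reindex (λ d → (t * toℕ d) mod p) (*-mod-injective p p-prime t t<p)
                   (λ e → ∑[ n < p ] triple n e) ⟩
    ∑[ e < p ] ∑[ n < p ] triple n e
      ≡⟨ ∑-comm {p} {p} (λ e n → triple n e) ⟩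
    ∑[ n < p ] ∑[ e < p ] triple n e ∎
    where open ≡-Reasoning

  module _ (N : ℕ) where

    progression : Fin p → Fin p → Fin N → ℕ
    progression a d i = toℕ a + toℕ i * toℕ d

    hits : Fin p → Fin p → Subset N
    hits a d = Vec.tabulate (λ i → lookup S (progression a d i mod p))

    ∈hits⇒χ≡1 : ∀ {a d i} → i ∈ hits a d → χ (progression a d i) ≡ 1
    ∈hits⇒χ≡1 {a} {d} {i} i∈ = cong ind (trans (sym (lookup∘tabulate _ i)) ([]=⇒lookup i∈))

    ∑∑∣hits∣ : ∑[ a < p ] ∑[ d < p ] ∣ hits a d ∣ ≡ p * (N * ∣ S ∣)
    ∑∑∣hits∣ = begin
      ∑[ a < p ] ∑[ d < p ] ∣ hits a d ∣
        ≡⟨ sum-cong-≗ {p} (λ a → sum-cong-≗ {p} (λ d →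
             trans (∣∣≡∑ (hits a d)) (sum-cong-≗ {N} (λ i → cong ind (lookup∘tabulate _ i))))) ⟩
      ∑[ a < p ] ∑[ d < p ] ∑[ i < N ] χ (progression a d i)
        ≡⟨ ∑-comm {p} {p} (λ a d → ∑[ i < N ] χ (progression a d i)) ⟩
      ∑[ d < p ] ∑[ a < p ] ∑[ i < N ] χ (progression a d i)
        ≡⟨ sum-cong-≗ {p} (λ d → ∑-comm {p} {N} (λ a i → χ (progression a d i))) ⟩
      ∑[ d < p ] ∑[ i < N ] ∑[ a < p ] χ (toℕ a + toℕ i * toℕ d)
        ≡⟨ sum-cong-≗ {p} (λ d → sum-cong-≗ {N} (λ i → ∑χ[+c]≡∣S∣ (toℕ i * toℕ d))) ⟩
      ∑[ d < p ] ∑[ i < N ] ∣ S ∣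
        ≡⟨ trans (sum-cong-≗ {p} (λ d → ∑-const N ∣ S ∣)) (∑-const p (N * ∣ S ∣)) ⟩
      p * (N * ∣ S ∣) ∎
      where open ≡-Reasoning

    below : Fin N → Fin N → ℕ
    below x z = ind ⌊ toℕ x <? toℕ z ⌋

    -- 3-APs of S at positions x < z < 2z - x of the progression; the third position may lie
    -- beyond N, which only enlarges the count.
    triplesAlong : Fin p → Fin p → ℕ
    triplesAlong a d = ∑[ x < N ] ∑[ z < N ]
      (below x z * triple (progression a d x mod p) (((toℕ z ∸ toℕ x) * toℕ d) mod p))

    below-< : ∀ {x z} → toℕ x < toℕ z → below x z ≡ 1
    below-< {x} {z} x<z with toℕ x <? toℕ z
    ... | yes _   = refl
    ... | no x≮z = ⊥-elim (x≮z x<z)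

    AP⇒triplesAlong>0 : ∀ {a d} (x y z : Fin N) → x ∈ hits a d → y ∈ hits a d → z ∈ hits a d →
                        toℕ x + toℕ y ≡ 2 * toℕ z → toℕ x < toℕ y → 0 < triplesAlong a d
    AP⇒triplesAlong>0 {a} {d} x y z x∈ y∈ z∈ x+y≡2z x<y =
      ≤-trans (≤-reflexive (sym term≡1)) (≤-trans (≤-∑ (term x) z) (≤-∑ (λ x' → sum (term x')) x))
      where
      open ≡-Reasoning
      P : Fin N → ℕ
      P = progression a d
      D t : ℕ
      D = toℕ d
      t = toℕ z ∸ toℕ x
      term : Fin N → Fin N → ℕ
      term x' z' = below x' z' * triple (P x' mod p) (((toℕ z' ∸ toℕ x') * D) mod p)
      +step : ∀ a x t d → a + x * d + t * d ≡ a + (x + t) * d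
      +step = solve-∀
      +2step : ∀ a x t d → a + x * d + 2 * (t * d) ≡ a + (x + 2 * t) * d
      +2step = solve-∀
      x<z : toℕ x < toℕ z
      x<z = proj₁ (3AP-shape x+y≡2z x<y)
      z≡x+t : toℕ z ≡ toℕ x + t
      z≡x+t = proj₁ (proj₂ (3AP-shape x+y≡2z x<y))
      y≡x+2t : toℕ y ≡ toℕ x + 2 * t
      y≡x+2t = proj₂ (proj₂ (3AP-shape x+y≡2z x<y))
      term≡1 : term x z ≡ 1
      term≡1 = begin
        below x z * triple (P x mod p) ((t * D) mod p)
          ≡⟨ cong₂ _*_ (below-< x<z) (triple-mod (P x) (t * D)) ⟩
        1 * (χ (P x) * χ (P x + t * D) * χ (P x + 2 * (t * D)))
          ≡⟨ cong₂ (λ u v → 1 * (χ (P x) * χ u * χ v))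
               (trans (+step (toℕ a) (toℕ x) t D) (cong (λ v → toℕ a + v * D) (sym z≡x+t)))
               (trans (+2step (toℕ a) (toℕ x) t D) (cong (λ v → toℕ a + v * D) (sym y≡x+2t))) ⟩
        1 * (χ (P x) * χ (P z) * χ (P y))
          ≡⟨ cong₂ (λ u v → 1 * (u * v * χ (P y))) (∈hits⇒χ≡1 x∈) (∈hits⇒χ≡1 z∈) ⟩
        1 * (1 * 1 * χ (P y))
          ≡⟨ cong (λ u → 1 * (1 * 1 * u)) (∈hits⇒χ≡1 y∈) ⟩
        1 ∎

    triplesAlong≡0⇒3APFree : ∀ {a d} → triplesAlong a d ≡ 0 → ThreeAPFree N (hits a d)
    triplesAlong≡0⇒3APFree none x y z x∈ y∈ z∈ 1+x+1+y≡2[1+z]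
      with <-cmp (toℕ x) (toℕ y) | pred-3AP 1+x+1+y≡2[1+z]
    ... | tri< x<y _ _ | x+y≡2z =
      ⊥-elim (n≮0 (subst (0 <_) none (AP⇒triplesAlong>0 x y z x∈ y∈ z∈ x+y≡2z x<y)))
    ... | tri≈ _ x≡y _ | _      = toℕ-injective x≡y
    ... | tri> _ _ y<x | x+y≡2z =
      ⊥-elim (n≮0 (subst (0 <_) none
        (AP⇒triplesAlong>0 y x z y∈ x∈ z∈ (trans (+-comm (toℕ y) (toℕ x)) x+y≡2z) y<x)))

    ∣hits∣≤r+triplesAlong*N : ∀ {r} → IsR3 N r → ∀ a d → ∣ hits a d ∣ ≤ r + triplesAlong a d * N
    ∣hits∣≤r+triplesAlong*N {r} (_ , r-max) a d with triplesAlong a d in none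
    ... | zero  = ≤-trans (r-max (hits a d) (triplesAlong≡0⇒3APFree none)) (m≤m+n r 0)
    ... | suc k = ≤-trans (∣p∣≤n (hits a d)) (≤-trans (m≤m+n N (k * N)) (m≤n+m _ r))

    pairs : ℕ
    pairs = ∑[ x < N ] ∑[ z < N ] below x z

    pairs+pairs≤N*N : pairs + pairs ≤ N * N
    pairs+pairs≤N*N = begin
      pairs + pairs
        ≡⟨ cong (pairs +_) (∑-comm {N} {N} below) ⟩
      pairs + ∑[ x < N ] ∑[ z < N ] below z x
        ≡⟨ sym (∑-distrib-+ {N} (λ x → ∑[ z < N ] below x z) (λ x → ∑[ z < N ] below z x)) ⟩
      ∑[ x < N ] (∑[ z < N ] below x z + ∑[ z < N ] below z x)
        ≡⟨ sum-cong-≗ {N} (λ x → sym (∑-distrib-+ {N} (below x) (λ z → below z x))) ⟩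
      ∑[ x < N ] ∑[ z < N ] (below x z + below z x)
        ≤⟨ ∑-mono-≤ (λ x → ∑-mono-≤ (λ z → below+below≤1 x z)) ⟩
      ∑[ x < N ] ∑[ z < N ] 1
        ≡⟨ trans (sum-cong-≗ {N} (λ x → ∑-const N 1)) (∑-const N (N * 1)) ⟩
      N * (N * 1)
        ≡⟨ cong (N *_) (*-identityʳ N) ⟩
      N * N ∎
      where
      open ≤-Reasoning
      below+below≤1 : ∀ x z → below x z + below z x ≤ 1
      below+below≤1 x z with toℕ x <? toℕ z | toℕ z <? toℕ x
      ... | yes x<z | yes z<x = ⊥-elim (<-asym x<z z<x)
      ... | yes _   | no _    = ≤-refl
      ... | no _    | yes _   = ≤-refl
      ... | no _    | no _    = z≤n

    ∑∑triplesAlong : Prime p → N ≤ p →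
                     ∑[ a < p ] ∑[ d < p ] triplesAlong a d ≡ pairs * triples
    ∑∑triplesAlong p-prime N≤p = begin
      ∑[ a < p ] ∑[ d < p ] ∑[ x < N ] ∑[ z < N ] term a d x z
        ≡⟨ ∑∑-comm term ⟩
      ∑[ x < N ] ∑[ z < N ] ∑[ a < p ] ∑[ d < p ] term a d x z
        ≡⟨ sum-cong-≗ {N} (λ x → sum-cong-≗ {N} (λ z → ∑∑term x z)) ⟩
      ∑[ x < N ] ∑[ z < N ] (below x z * triples)
        ≡⟨ sum-cong-≗ {N} (λ x → sym (*-distribʳ-sum triples (below x))) ⟩
      ∑[ x < N ] (∑[ z < N ] below x z * triples)
        ≡⟨ sym (*-distribʳ-sum triples (λ x → ∑[ z < N ] below x z)) ⟩
      pairs * triples ∎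
      where
      open ≡-Reasoning
      term : Fin p → Fin p → Fin N → Fin N → ℕ
      term a d x z = below x z * triple (progression a d x mod p) (((toℕ z ∸ toℕ x) * toℕ d) mod p)
      ∑∑term : ∀ x z → ∑[ a < p ] ∑[ d < p ] term a d x z ≡ below x z * triples
      ∑∑term x z with toℕ x <? toℕ z
      ... | no _    = trans (sum-cong-≗ {p} (λ a → sum-replicate-zero p)) (sum-replicate-zero p)
      ... | yes x<z = begin
        ∑[ a < p ] ∑[ d < p ] (1 * triple (progression a d x mod p) ((t * toℕ d) mod p))
          ≡⟨ sym (trans (*-distribˡ-sum {p} 1 _) (sum-cong-≗ {p} (λ a → *-distribˡ-sum {p} 1 _))) ⟩
        1 * ∑[ a < p ] ∑[ d < p ] triple ((toℕ a + toℕ x * toℕ d) mod p) ((t * toℕ d) mod p)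
          ≡⟨ cong (1 *_) (∑∑triple-affine p-prime (toℕ x) t {{>-nonZero (m<n⇒0<n∸m x<z)}}
                            (≤-<-trans (m∸n≤m (toℕ z) (toℕ x)) (<-≤-trans (toℕ<n z) N≤p))) ⟩
        1 * triples ∎
        where
        t : ℕ
        t = toℕ z ∸ toℕ x

    ∑∑∣hits∣-bound : ∀ {r} → Prime p → N ≤ p → IsR3 N r →
                 p * (N * ∣ S ∣) ≤ p * (p * r) + pairs * triples * N
    ∑∑∣hits∣-bound {r} p-prime N≤p isR3 = begin
      p * (N * ∣ S ∣)
        ≡⟨ sym ∑∑∣hits∣ ⟩
      ∑[ a < p ] ∑[ d < p ] ∣ hits a d ∣
        ≤⟨ ∑-mono-≤ (λ a → ∑-mono-≤ (∣hits∣≤r+triplesAlong*N isR3 a)) ⟩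
      ∑[ a < p ] ∑[ d < p ] (r + triplesAlong a d * N)
        ≡⟨ sum-cong-≗ {p} (λ a → trans (∑-distrib-+ {p} (λ _ → r) (λ d → triplesAlong a d * N))
                                        (cong₂ _+_ (∑-const p r) (sym (*-distribʳ-sum N (triplesAlong a))))) ⟩
      ∑[ a < p ] (p * r + (∑[ d < p ] triplesAlong a d) * N)
        ≡⟨ trans (∑-distrib-+ {p} (λ _ → p * r) (λ a → (∑[ d < p ] triplesAlong a d) * N))
                 (cong₂ _+_ (∑-const p (p * r))
                            (sym (*-distribʳ-sum N (λ a → ∑[ d < p ] triplesAlong a d)))) ⟩
      p * (p * r) + (∑[ a < p ] ∑[ d < p ] triplesAlong a d) * N
        ≡⟨ cong (λ u → p * (p * r) + u * N) (∑∑triplesAlong p-prime N≤p) ⟩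
      p * (p * r) + pairs * triples * N ∎
      where open ≤-Reasoning

  count-lower-bound : ∀ {N r} → Prime p → N ≤ p → IsR3 N r →
                      2 * r * p ≤ ∣ S ∣ * N → 2 * r * (p * p) ≤ count p S * N ^ 3
  count-lower-bound {N} {r} p-prime N≤p isR3 dense =
    subst (λ c → 2 * r * (p * p) ≤ c * N ^ 3) (sym count≡triples)
      (density-arithmetic {r} {p} {s = ∣ S ∣} {K = pairs N} dense
        (∑∑∣hits∣-bound N p-prime N≤p isR3) (pairs+pairs≤N*N N))

frac-≤⇔ : ∀ {a b c d} → 1 ≤ b → 1 ≤ d → frac a b ≤ᵘ frac c d ⇔ a * d ≤ c * b
frac-≤⇔ {a} {b} {c} {d} 1≤b 1≤d = mk⇔
  (λ where (*≤* ad≤cb) → subst₂ _≤_ (cong (a *_) d≡) (cong (c *_) b≡)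
                           (ℤ.drop‿+≤+ (subst₂ ℤ._≤_ (sym (ℤ.pos-* a _)) (sym (ℤ.pos-* c _)) ad≤cb)))
  (λ ad≤cb → *≤* (subst₂ ℤ._≤_ (ℤ.pos-* a _) (ℤ.pos-* c _)
                    (ℤ.+≤+ (subst₂ _≤_ (cong (a *_) (sym d≡)) (cong (c *_) (sym b≡)) ad≤cb))))
  where
  b≡ : suc (b ∸ 1) ≡ b
  b≡ = m+[n∸m]≡n 1≤b
  d≡ : suc (d ∸ 1) ≡ d
  d≡ = m+[n∸m]≡n 1≤d

Λ-lower-bound : ∀ p .{{_ : NonZero p}} → Prime p → ∀ {N} → 1 ≤ N → N ≤ p → ∀ {r} → IsR3 N r →
                ∀ (S : Subset p) → frac (2 * r * p) N ≤ᵘ frac ∣ S ∣ 1 →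
                frac (2 * r) (N ^ 3) ≤ᵘ Λ p S
Λ-lower-bound p p-prime {N} 1≤N N≤p {r} isR3 S dense =
  Equivalence.from (frac-≤⇔ (m^n>0 N {{>-nonZero 1≤N}} 3) (*-mono-≤ 1≤p 1≤p))
    (Counting.count-lower-bound p S p-prime N≤p isR3
      (subst (_≤ ∣ S ∣ * N) (*-identityʳ (2 * r * p)) (Equivalence.to (frac-≤⇔ 1≤N ≤-refl) dense)))
  where
  1≤p : 1 ≤ p
  1≤p = >-nonZero⁻¹ p

lemma1 : ∃[ C ] (∀ (p : ℕ) .{{_ : NonZero p}} → Prime p →
           ∀ (N : ℕ) → 2 ≤ N → N ≤ p →
           ∀ (r : ℕ) → IsR3 N r →
           ∀ (S : Subset p) →
           frac (2 * r * p) N ≤ᵘ frac ∣ S ∣ 1 →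
           frac (2 * r) (N ^ 3 + C * N ^ 2) ≤ᵘ Λ p S)
lemma1 = 0 , λ p p-prime N 2≤N N≤p r isR3 S dense →
  subst (λ b → frac (2 * r) b ≤ᵘ Λ p S) (sym (+-identityʳ (N ^ 3)))
    (Λ-lower-bound p p-prime (≤-trans (s≤s z≤n) 2≤N) N≤p isR3 S dense)
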